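{- For $a\in\{0,1\}$ let $p_{n,a}(t)=\prod_{i=1}^n(a+t_{i-1}+t_i)$ with $t_0:=0$. Then $S_{max}(BW_n)=\operatorname{supp} p_{n,0}$ and $S(BW_n)=\operatorname{supp} p_{n,1}$, and $|S_{max}(BW_n)|=2^{n-1}$ and $|S(BW_n)|\le 2\cdot 3^{n-1}$.
   Context: The broken wheel graph $BW_n$ is the multigraph on vertices $0,\dots,n$ with two parallel edges between $0$ and $1$, one edge $0$–$i$ for each $2\le i\le n$, and one edge $i$–$(i+1)$ for each $1\le i\le n-1$. For $1\le i\le k\le j\le n$, $d(i,k,j)$ is the number of edges joining $k$ to a vertex outside $\{i,\dots,j\}$. $S(BW_n)$ is the set of parking functions: $s\in\mathbb{N}^n$ such that for all $1\le i\le j\le n$ there is $k\in\{i,\dots,j\}$ with $s(k)<d(i,k,j)$. $S_{max}(BW_n)=\{s\in S(BW_n):\sum_i s(i)=n\}$. The monomial support of a polynomial $p$ is $\operatorname{supp}p=\{s\in\mathbb{N}^n: (\partial_t^s p)(0)\neq 0\}$, i.e. the exponent vectors of monomials appearing with nonzero coefficient. -}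

module Defs where

open import Data.Nat using (ℕ; zero; suc; _+_; _*_; _∸_; _≤_; _<_; _<?_; _≟_)
open import Data.Bool using (Bool; true; false; if_then_else_; _∧_; _∨_; not)
open import Data.Product using (_×_; _,_; proj₁; proj₂; ∃-syntax)
open import Data.List using (List; []; _∷_; _++_; map; concatMap; foldr; filter; upTo; length)
import Data.List as L
open import Data.Nat.ListAction using () renaming (sum to lsum)
open import Data.Vec using (Vec; zipWith; replicate; tabulate; lookup)
import Data.Vec as V
open import Data.Vec.Properties using (≡-dec)
open import Data.Fin using (Fin; toℕ; fromℕ<)
import Data.Fin as F
open import Relation.Nullary using (yes; no; ¬_)
open import Relation.Nullary.Decidable using (⌊_⌋)
open import Relation.Binary.PropositionalEquality using (_≡_; _≢_)

-- The broken wheel multigraph BW_n, as a list of edges (multiset).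
-- Vertices are natural numbers 0..n.

BWedges : ℕ → List (ℕ × ℕ)
BWedges n = (0 , 1) ∷ (0 , 1) ∷
            (map (λ i → (0 , i)) (filter (λ i → 2 Data.Nat.≤? i) (map suc (upTo n)))
             ++ map (λ i → (i , suc i)) (map suc (upTo (n ∸ 1))))

outside : ℕ → ℕ → ℕ → Bool
outside i j v = ⌊ v <? i ⌋ ∨ ⌊ j <? v ⌋

edgeCount : ℕ → ℕ → ℕ → ℕ × ℕ → ℕ
edgeCount i k j (u , v) =
  (if ⌊ u ≟ k ⌋ ∧ outside i j v then 1 else 0) +
  (if ⌊ v ≟ k ⌋ ∧ outside i j u then 1 else 0)

-- d(i,k,j): number of edges of BW_n joining k to a vertex outside {i..j}
d : ℕ → ℕ → ℕ → ℕ → ℕ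
d n i k j = lsum (map (edgeCount i k j) (BWedges n))

-- s(k) for 1 ≤ k ≤ n (value 0 outside this range, never used there)
at : ∀ {n} → Vec ℕ n → ℕ → ℕ
at {n} s zero = 0
at {n} s (suc k) with k <? n
... | yes k<n = lookup s (fromℕ< k<n)
... | no _ = 0

S : (n : ℕ) → Vec ℕ n → Set
S n s = ∀ i j → 1 ≤ i → i ≤ j → j ≤ n →
        ∃[ k ] (i ≤ k × k ≤ j × at s k < d n i k j)

Smax : (n : ℕ) → Vec ℕ n → Set
Smax n s = S n s × V.sum s ≡ n

-- Polynomials in variables t_1..t_n with ℕ coefficients, as finite formal
-- sums of terms (coefficient , exponent vector).

Poly : ℕ → Set
Poly n = List (ℕ × Vec ℕ n)

const : ∀ {n} → ℕ → Poly n
const a = (a , replicate _ 0) ∷ []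

-- the variable t_{i+1} (i : Fin n)
var : ∀ {n} → Fin n → Poly n
var i = (1 , tabulate (λ j → if ⌊ i F.≟ j ⌋ then 1 else 0)) ∷ []

_⊕_ : ∀ {n} → Poly n → Poly n → Poly n
p ⊕ q = p ++ q

_⊗_ : ∀ {n} → Poly n → Poly n → Poly n
p ⊗ q = concatMap (λ t → map (λ u → (proj₁ t * proj₁ u , zipWith _+_ (proj₂ t) (proj₂ u))) q) p

prodP : ∀ {n} → List (Poly n) → Poly n
prodP = foldr _⊗_ (const 1)

-- t_k for k ∈ ℕ, with t_0 := 0 (the zero polynomial)
t : ∀ {n} → ℕ → Poly n
t zero = []
t {n} (suc k) with k <? n
... | yes k<n = var (fromℕ< k<n)
... | no _ = []

pna : (n a : ℕ) → Poly n
pna n a = prodP (map (λ i → (const a ⊕ t (i ∸ 1)) ⊕ t i) (map suc (upTo n)))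

coeff : ∀ {n} → Poly n → Vec ℕ n → ℕ
coeff p s = lsum (map proj₁ (filter (λ u → ≡-dec _≟_ (proj₂ u) s) p))

supp : ∀ {n} → Poly n → Vec ℕ n → Set
supp p s = coeff p s ≢ 0

-- A monomial t^s of p_{n,a} = ∏_i (a + t_{i-1} + t_i) comes from choosing one term in every factor:
-- if factor i contributes t_{i-1}^{u_i} t_i^{y_i}, with (u_i , y_i) = (0,0) (only when a ≠ 0), (1,0) or
-- (0,1), then s_i = y_i + u_{i+1}, where u_1 = 0 because t_0 = 0, and u_{n+1} = 0.  The coefficients are
-- natural numbers, so nothing cancels and supp p_{n,a} consists of exactly these vectors.
--
-- In BW_n a vertex k of {i, …, j} has 1 + [k = i] + [k = j < n] edges leaving the interval.  Peeling
-- off the first vertex shows that s is a parking function iff its entries are at most 2 and every 2 is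
-- followed by a run of 1s ending in a 0: this is the automaton of the choices for a = 1, whose state is
-- whether the next factor takes its left term.  A parking function has weight n iff no constant term is
-- chosen, i.e. iff it also arises for a = 0.  For a = 0 the choices are determined by s and there are
-- 2^{n-1} of them; for a = 1 there are 2·3^{n-1} choices, which bounds the number of vectors.

module Submission where

open import Data.Bool using (Bool; true; false; if_then_else_; _∧_; _∨_)
open import Data.Bool.Properties using (∧-zeroʳ; ∨-identityʳ)
open import Data.Fin using (Fin; suc; fromℕ<)
import Data.Fin as F
open import Data.List using (List; []; _∷_; _++_; map; concatMap; length; deduplicate; applyUpTo; filter; upTo)
open import Data.List.Properties using (length-++; length-map; map-++; map-∘; map-upTo; map-cong; length-deduplicate)
open import Data.List.Membership.Propositional using (_∈_; lose; find)
open import Data.List.Membership.Propositional.Properties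
  using (∈-map⁺; ∈-map⁻; ∈-++⁺ˡ; ∈-++⁺ʳ; ∈-++⁻; ∈-concatMap⁺; ∈-concatMap⁻; deduplicate-∈⇔)
open import Data.List.Relation.Unary.All using ([])
open import Data.List.Relation.Unary.AllPairs using ([]; _∷_)
open import Data.List.Relation.Unary.Any using (here; there)
open import Data.List.Relation.Unary.Unique.Propositional using (Unique)
open import Data.List.Relation.Unary.Unique.Propositional.Properties using (map⁺; ++⁺)
open import Data.List.Relation.Unary.Unique.DecPropositional.Properties using (deduplicate-!)
open import Data.Nat using (ℕ; zero; suc; _+_; _*_; _^_; _∸_; _≤_; _<_; z≤n; s≤s; z<s; s<s; _≟_; _<?_; _≤?_)
open import Data.Nat.ListAction using () renaming (sum to lsum)
open import Data.Nat.ListAction.Properties using (sum-++)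
open import Data.Nat.Properties
open import Data.Nat.Solver using (module +-*-Solver)
open import Data.Product using (_×_; _,_; proj₁; proj₂; ∃-syntax)
open import Data.Sum using (_⊎_; inj₁; inj₂; [_,_]′)
open import Data.Vec using (Vec; []; _∷_; zipWith; replicate; tabulate)
import Data.Vec as V
open import Data.Vec.Properties using (∷-injectiveˡ; ∷-injectiveʳ; ≡-dec; zipWith-identityˡ; tabulate-cong)
open import Function using (_∘_; id)
open import Function.Bundles using (_⇔_; mk⇔; Equivalence)
open import Function.Properties.Equivalence using () renaming (trans to ⇔-trans; sym to ⇔-sym)
open import Relation.Binary.Definitions using (DecidableEquality)
open import Relation.Binary.PropositionalEquality
open import Relation.Nullary using (¬_; contradiction; yes; no)
open import Relation.Nullary.Decidable using (⌊_⌋; does; ⌊⌋-map′; isYes≗does; dec-true; dec-false)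
import Relation.Unary as U

open import Defs

-- Choice sequences

-- Term a u y: the factor a + t_{i-1} + t_i has the monomial t_{i-1}^u t_i^y.
data Term : ℕ → ℕ → ℕ → Set where
  constant : ∀ {a} → Term (suc a) 0 0
  left     : ∀ {a} → Term a 1 0
  right    : ∀ {a} → Term a 0 1

-- Chain a u s: s = (y_i + u_{i+1})_i for terms (u_i , y_i) of the factors, with u_1 = u and u_{m+1} = 0.
data Chain (a : ℕ) : ℕ → ∀ {m} → Vec ℕ m → Set where
  []  : Chain a 0 []
  _∷_ : ∀ {u y u′ m} {s : Vec ℕ m} → Term a u y → Chain a u′ s → Chain a u (y + u′ ∷ s)

Term-weaken : ∀ {a b u y} → Term a u y → Term (suc b) u y
Term-weaken constant = constant
Term-weaken left     = left
Term-weaken right    = right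

Chain-weaken : ∀ {a b u m} {s : Vec ℕ m} → Chain a u s → Chain (suc b) u s
Chain-weaken []      = []
Chain-weaken (τ ∷ c) = Term-weaken τ ∷ Chain-weaken c

Chain-start≤1 : ∀ {a u m} {s : Vec ℕ m} → Chain a u s → u ≤ 1
Chain-start≤1 []             = z≤n
Chain-start≤1 (constant ∷ _) = z≤n
Chain-start≤1 (left ∷ _)     = ≤-refl
Chain-start≤1 (right ∷ _)    = z≤n

Term-weight≤1 : ∀ {a u y} → Term a u y → u + y ≤ 1
Term-weight≤1 constant = z≤n
Term-weight≤1 left     = ≤-refl
Term-weight≤1 right    = ≤-refl

Term₀-weight : ∀ {u y} → Term 0 u y → u + y ≡ 1
Term₀-weight left  = refl
Term₀-weight right = refl

Term-tight : ∀ {a u y} → Term a u y → u + y ≡ 1 → Term 0 u y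
Term-tight left  _ = left
Term-tight right _ = right

private
  regroup : ∀ y u′ t u → (y + u′ + t) + u ≡ (u + y) + (t + u′)
  regroup = solve 4 (λ y u′ t u → (y :+ u′ :+ t) :+ u := (u :+ y) :+ (t :+ u′)) refl
    where open +-*-Solver

  split-tight : ∀ {p q m} → p ≤ 1 → q ≤ m → p + q ≡ suc m → p ≡ 1 × q ≡ m
  split-tight {zero}        _         q≤m refl = contradiction q≤m (n≮n _)
  split-tight {suc zero}    _         _   eq   = refl , suc-injective eq
  split-tight {suc (suc _)} (s≤s ()) _   _

Chain₀-sum : ∀ {u m} {s : Vec ℕ m} → Chain 0 u s → V.sum s + u ≡ m
Chain₀-sum []                                          = refl
Chain₀-sum {u = u} {s = _ ∷ s} (_∷_ {y = y} {u′} τ c) = begin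
  (y + u′ + V.sum s) + u   ≡⟨ regroup y u′ (V.sum s) u ⟩
  (u + y) + (V.sum s + u′) ≡⟨ cong₂ _+_ (Term₀-weight τ) (Chain₀-sum c) ⟩
  suc _                    ∎
  where open ≡-Reasoning

Chain-sum≤ : ∀ {a u m} {s : Vec ℕ m} → Chain a u s → V.sum s + u ≤ m
Chain-sum≤ []                                          = z≤n
Chain-sum≤ {u = u} {s = _ ∷ s} (_∷_ {y = y} {u′} τ c) = begin
  (y + u′ + V.sum s) + u   ≡⟨ regroup y u′ (V.sum s) u ⟩
  (u + y) + (V.sum s + u′) ≤⟨ +-mono-≤ (Term-weight≤1 τ) (Chain-sum≤ c) ⟩
  suc _                    ∎
  where open ≤-Reasoning

Chain-tight : ∀ {a u m} {s : Vec ℕ m} → Chain a u s → V.sum s + u ≡ m → Chain 0 u s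
Chain-tight []                                 _  = []
Chain-tight {s = _ ∷ s} (_∷_ {y = y} {u′} τ c) eq
  with τ-tight , c-tight ← split-tight (Term-weight≤1 τ) (Chain-sum≤ c) (trans (sym (regroup y u′ (V.sum s) _)) eq)
  = Term-tight τ τ-tight ∷ Chain-tight c c-tight

-- Monomials of the formal polynomials

fromBool : Bool → ℕ
fromBool b = if b then 1 else 0

times : ∀ {n} → ℕ × Vec ℕ n → ℕ × Vec ℕ n → ℕ × Vec ℕ n
times (c₁ , e₁) (c₂ , e₂) = c₁ * c₂ , zipWith _+_ e₁ e₂

private
  *≢0⁺ : ∀ {m n} → m ≢ 0 → n ≢ 0 → m * n ≢ 0
  *≢0⁺ m≢0 n≢0 eq = [ m≢0 , n≢0 ]′ (m*n≡0⇒m≡0∨n≡0 _ eq)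

  *≢0⁻ : ∀ m n → m * n ≢ 0 → m ≢ 0 × n ≢ 0
  *≢0⁻ m n mn≢0 = (λ { refl → mn≢0 refl }) , (λ { refl → mn≢0 (*-zeroʳ m) })

  tabulate-const-0 : ∀ {m} → tabulate {n = m} (λ _ → 0) ≡ replicate m 0
  tabulate-const-0 {zero}  = refl
  tabulate-const-0 {suc m} = cong (0 ∷_) tabulate-const-0

module _ {n : ℕ} where

  Occurs : Poly n → Vec ℕ n → Set
  Occurs p s = ∃[ c ] ((c , s) ∈ p × c ≢ 0)

  -- Coefficients are natural numbers, so nothing cancels in a formal sum.
  supp⇔Occurs : ∀ p (s : Vec ℕ n) → supp p s ⇔ Occurs p s
  supp⇔Occurs p s = mk⇔ (supp⇒Occurs p) (Occurs⇒supp p)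
    where
    supp⇒Occurs : ∀ p → supp p s → Occurs p s
    supp⇒Occurs []            c≢0 = contradiction refl c≢0
    supp⇒Occurs ((c , e) ∷ p) c≢0 with ≡-dec _≟_ e s | c ≟ 0
    ... | yes refl | no c≢0′ = c , here refl , c≢0′
    ... | yes refl | yes refl with c′ , ∈p , c′≢0 ← supp⇒Occurs p c≢0 = c′ , there ∈p , c′≢0
    ... | no _     | _        with c′ , ∈p , c′≢0 ← supp⇒Occurs p c≢0 = c′ , there ∈p , c′≢0

    Occurs⇒supp : ∀ p → Occurs p s → supp p s
    Occurs⇒supp ((c , e) ∷ p) (c′ , here refl , c′≢0) with ≡-dec _≟_ s s
    ... | yes _  = c′≢0 ∘ m+n≡0⇒m≡0 c′
    ... | no s≢s = contradiction refl s≢s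
    Occurs⇒supp ((c , e) ∷ p) (c′ , there ∈p , c′≢0) with ≡-dec _≟_ e s
    ... | yes _ = Occurs⇒supp p (c′ , ∈p , c′≢0) ∘ m+n≡0⇒n≡0 c
    ... | no _  = Occurs⇒supp p (c′ , ∈p , c′≢0)

  Occurs-⊕⁻ : ∀ p q {s} → Occurs (p ⊕ q) s → Occurs p s ⊎ Occurs q s
  Occurs-⊕⁻ p q (c , ∈pq , c≢0) with ∈-++⁻ p ∈pq
  ... | inj₁ ∈p = inj₁ (c , ∈p , c≢0)
  ... | inj₂ ∈q = inj₂ (c , ∈q , c≢0)

  Occurs-⊕⁺ˡ : ∀ p q {s} → Occurs p s → Occurs (p ⊕ q) s
  Occurs-⊕⁺ˡ p q (c , ∈p , c≢0) = c , ∈-++⁺ˡ ∈p , c≢0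

  Occurs-⊕⁺ʳ : ∀ p q {s} → Occurs q s → Occurs (p ⊕ q) s
  Occurs-⊕⁺ʳ p q (c , ∈q , c≢0) = c , ∈-++⁺ʳ p ∈q , c≢0

  Occurs-⊗⁻ : ∀ p q {s} → Occurs (p ⊗ q) s →
              ∃[ e₁ ] ∃[ e₂ ] (Occurs p e₁ × Occurs q e₂ × s ≡ zipWith _+_ e₁ e₂)
  Occurs-⊗⁻ ((c₁ , e₁) ∷ p) q (c , ∈pq , c≢0) with ∈-++⁻ (map (times (c₁ , e₁)) q) ∈pq
  ... | inj₁ ∈head with (c₂ , e₂) , ∈q , refl ← ∈-map⁻ _ ∈head =
    let c₁≢0 , c₂≢0 = *≢0⁻ c₁ c₂ c≢0 in e₁ , e₂ , (c₁ , here refl , c₁≢0) , (c₂ , ∈q , c₂≢0) , refl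
  ... | inj₂ ∈tail with e₁′ , e₂ , (c₁′ , ∈p , c₁′≢0) , occ₂ , eq ← Occurs-⊗⁻ p q (c , ∈tail , c≢0) =
    e₁′ , e₂ , (c₁′ , there ∈p , c₁′≢0) , occ₂ , eq

  Occurs-⊗⁺ : ∀ p q {e₁ e₂} → Occurs p e₁ → Occurs q e₂ → Occurs (p ⊗ q) (zipWith _+_ e₁ e₂)
  Occurs-⊗⁺ ((c₁ , e₁) ∷ p) q (_ , here refl , c₁≢0) (c₂ , ∈q , c₂≢0) =
    c₁ * c₂ , ∈-++⁺ˡ (∈-map⁺ (times (c₁ , e₁)) ∈q) , *≢0⁺ c₁≢0 c₂≢0
  Occurs-⊗⁺ (x ∷ p) q (c₁ , there ∈p , c₁≢0) occ₂
    with c , ∈pq , c≢0 ← Occurs-⊗⁺ p q (c₁ , ∈p , c₁≢0) occ₂ =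
    c , ∈-++⁺ʳ (map (times x) q) ∈pq , c≢0

  Occurs-const⁻ : ∀ {a s} → Occurs (const a) s → a ≢ 0 × s ≡ replicate n 0
  Occurs-const⁻ (_ , here refl , a≢0) = a≢0 , refl

  Occurs-const⁺ : ∀ {a} → a ≢ 0 → Occurs (const a) (replicate n 0)
  Occurs-const⁺ {a} a≢0 = a , here refl , a≢0

Occurs-t₁⁻ : ∀ {n x s} → Occurs (t {suc n} 1) (x ∷ s) → x ≡ 1 × s ≡ replicate n 0
Occurs-t₁⁻ (_ , here refl , _) = refl , tabulate-const-0

Occurs-t₁⁺ : ∀ {n} → Occurs (t {suc n} 1) (1 ∷ replicate n 0)
Occurs-t₁⁺ = 1 , here (cong (λ v → 1 , 1 ∷ v) (sym tabulate-const-0)) , λ ()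

shift₁ : ∀ {n} → ℕ × Vec ℕ n → ℕ × Vec ℕ (suc n)
shift₁ (c , e) = c , 0 ∷ e

shift : ∀ {n} → Poly n → Poly (suc n)
shift = map shift₁

Occurs-shift⁻ : ∀ {n} (p : Poly n) {x s} → Occurs (shift p) (x ∷ s) → x ≡ 0 × Occurs p s
Occurs-shift⁻ p (c , ∈shift , c≢0) with _ , ∈p , refl ← ∈-map⁻ _ ∈shift = refl , c , ∈p , c≢0

Occurs-shift⁺ : ∀ {n} (p : Poly n) {s} → Occurs p s → Occurs (shift p) (0 ∷ s)
Occurs-shift⁺ p (c , ∈p , c≢0) = c , ∈-map⁺ _ ∈p , c≢0

shift-⊗ : ∀ {n} (p q : Poly n) → shift (p ⊗ q) ≡ shift p ⊗ shift q
shift-⊗ []      q = refl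
shift-⊗ (x ∷ p) q = begin
  shift (map (times x) q ++ p ⊗ q)              ≡⟨ map-++ shift₁ (map (times x) q) (p ⊗ q) ⟩
  shift (map (times x) q) ++ shift (p ⊗ q)      ≡⟨ cong₂ _++_ (sym (map-∘ q)) (shift-⊗ p q) ⟩
  map (shift₁ ∘ times x) q ++ shift p ⊗ shift q ≡⟨ cong (_++ shift p ⊗ shift q) (map-∘ q) ⟩
  shift (x ∷ p) ⊗ shift q                       ∎
  where open ≡-Reasoning

var-shift : ∀ {n} (i : Fin n) → var (suc i) ≡ shift (var i)
var-shift i = cong (λ v → (1 , 0 ∷ v) ∷ []) (tabulate-cong λ j → cong fromBool (⌊⌋-map′ _ _ (i F.≟ j)))

t-shift : ∀ {n} k → t {suc n} (suc (suc k)) ≡ shift (t {n} (suc k))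
t-shift {n} k with suc k <? suc n | k <? n
... | yes _     | yes k<n = var-shift (fromℕ< k<n)
... | no _      | no _    = refl
... | no ¬k<n   | yes k<n = contradiction (s≤s k<n) ¬k<n
... | yes 1+k<n | no ¬k<n = contradiction (≤-pred 1+k<n) ¬k<n

factor : ∀ {n} → ℕ → ℕ → Poly n
factor a i = (const a ⊕ t (i ∸ 1)) ⊕ t i

Π : ∀ {n} → ℕ → ℕ → ℕ → Poly n
Π a k zero    = const 1
Π a k (suc r) = factor a k ⊗ Π a (suc k) r

pna≡Π : ∀ n a → pna n a ≡ Π a 1 n
pna≡Π n a = trans (cong (prodP ∘ map (factor a)) (map-upTo suc n)) (product≡Π suc 1 n λ _ → refl)
  where
  product≡Π : ∀ f k r → (∀ i → f i ≡ k + i) → prodP (map (factor a) (applyUpTo f r)) ≡ Π {n} a k r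
  product≡Π f k zero    f≡ = refl
  product≡Π f k (suc r) f≡ = cong₂ _⊗_ (cong (factor a) (trans (f≡ 0) (+-identityʳ k)))
    (product≡Π (f ∘ suc) (suc k) r λ i → trans (f≡ (suc i)) (+-suc k i))

factor-shift : ∀ {n} a k → factor {suc n} a (3 + k) ≡ shift (factor a (2 + k))
factor-shift a k = begin
  (const a ⊕ t (2 + k)) ⊕ t (3 + k)
    ≡⟨ cong₂ (λ p q → (const a ⊕ p) ⊕ q) (t-shift k) (t-shift (suc k)) ⟩
  (shift (const a) ⊕ shift (t (1 + k))) ⊕ shift (t (2 + k))
    ≡⟨ cong (_⊕ shift (t (2 + k))) (map-++ shift₁ (const a) (t (1 + k))) ⟨
  shift (const a ⊕ t (1 + k)) ⊕ shift (t (2 + k))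
    ≡⟨ map-++ shift₁ (const a ⊕ t (1 + k)) (t (2 + k)) ⟨
  shift ((const a ⊕ t (1 + k)) ⊕ t (2 + k)) ∎
  where open ≡-Reasoning

Π-shift : ∀ {n} a k r → Π {suc n} a (3 + k) r ≡ shift (Π a (2 + k) r)
Π-shift a k zero    = refl
Π-shift a k (suc r) = trans (cong₂ _⊗_ (factor-shift a k) (Π-shift a (suc k) r))
                            (sym (shift-⊗ (factor a (2 + k)) (Π a (3 + k) r)))

Occurs-Π₃⁻ : ∀ {n} a r {x e} → Occurs (Π {suc n} a 3 r) (x ∷ e) → x ≡ 0 × Occurs (Π a 2 r) e
Occurs-Π₃⁻ a r occ = Occurs-shift⁻ (Π a 2 r) (subst (λ p → Occurs p _) (Π-shift a 0 r) occ)

Occurs-Π₃⁺ : ∀ {n} a r {e} → Occurs (Π {n} a 2 r) e → Occurs (Π a 3 r) (0 ∷ e)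
Occurs-Π₃⁺ a r occ = subst (λ p → Occurs p _) (sym (Π-shift a 0 r)) (Occurs-shift⁺ (Π a 2 r) occ)

Occurs-factor₁⁻ : ∀ {n a y z} → Occurs (factor {suc n} a 1) (y ∷ z) → Term a 0 y × z ≡ replicate n 0
Occurs-factor₁⁻ {a = a} occ with Occurs-⊕⁻ (const a ⊕ []) (t 1) occ
... | inj₂ occ₁ with refl , z≡0 ← Occurs-t₁⁻ occ₁ = right , z≡0
... | inj₁ occ₀ with Occurs-⊕⁻ (const a) [] occ₀
...   | inj₂ (_ , () , _)
...   | inj₁ occ-const with a | Occurs-const⁻ occ-const
...     | zero  | a≢0 , _  = contradiction refl a≢0
...     | suc _ | _ , refl = constant , refl

Occurs-factor₁⁺ : ∀ {n a y} → Term a 0 y → Occurs (factor {suc n} a 1) (y ∷ replicate n 0)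
Occurs-factor₁⁺ {a = a} constant = Occurs-⊕⁺ˡ _ (t 1) (Occurs-⊕⁺ˡ (const a) [] (Occurs-const⁺ λ ()))
Occurs-factor₁⁺ {a = a} right    = Occurs-⊕⁺ʳ (const a ⊕ []) _ Occurs-t₁⁺

Occurs-factor₂⁻ : ∀ {n a u z} → Occurs (factor {suc n} a 2) (u ∷ z) →
                  (u ≡ 1 × z ≡ replicate n 0) ⊎ (u ≡ 0 × Occurs (factor a 1) z)
Occurs-factor₂⁻ {a = a} {u} {z} occ with Occurs-⊕⁻ (const a ⊕ t 1) (t 2) occ
... | inj₂ occ₂ with refl , occ₁ ← Occurs-shift⁻ (t 1) (subst (λ p → Occurs p (u ∷ z)) (t-shift 0) occ₂) =
  inj₂ (refl , Occurs-⊕⁺ʳ (const a ⊕ []) (t 1) occ₁)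
... | inj₁ occ₀ with Occurs-⊕⁻ (const a) (t 1) occ₀
...   | inj₂ occ₁ = inj₁ (Occurs-t₁⁻ occ₁)
...   | inj₁ occ-const with a≢0 , refl ← Occurs-const⁻ occ-const =
  inj₂ (refl , Occurs-⊕⁺ˡ (const a ⊕ []) (t 1) (Occurs-⊕⁺ˡ (const a) [] (Occurs-const⁺ a≢0)))

Occurs-factor₂⁺ : ∀ {n a u z} → (u ≡ 1 × z ≡ replicate n 0) ⊎ (u ≡ 0 × Occurs (factor a 1) z) →
                  Occurs (factor {suc n} a 2) (u ∷ z)
Occurs-factor₂⁺ {a = a} (inj₁ (refl , refl)) =
  Occurs-⊕⁺ˡ (const a ⊕ t 1) (t 2) (Occurs-⊕⁺ʳ (const a) (t 1) Occurs-t₁⁺)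
Occurs-factor₂⁺ {a = a} (inj₂ (refl , occ)) with Occurs-⊕⁻ (const a ⊕ []) (t 1) occ
... | inj₂ occ₁ = Occurs-⊕⁺ʳ (const a ⊕ t 1) (t 2)
  (subst (λ p → Occurs p (0 ∷ _)) (sym (t-shift 0)) (Occurs-shift⁺ (t 1) occ₁))
... | inj₁ occ₀ with Occurs-⊕⁻ (const a) [] occ₀
...   | inj₂ (_ , () , _)
...   | inj₁ occ-const with a≢0 , refl ← Occurs-const⁻ occ-const =
  Occurs-⊕⁺ˡ (const a ⊕ t 1) (t 2) (Occurs-⊕⁺ˡ (const a) (t 1) (Occurs-const⁺ a≢0))

-- In Π a 2 r the first variable occurs only as the left term of the first factor, so its exponent
-- is the start state of the chain formed by the other exponents.
Occurs-Π₁⇒Chain-step : ∀ {a r} → (∀ {u} {s : Vec ℕ r} → Occurs (Π {suc r} a 2 r) (u ∷ s) → Chain a u s) →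
                       ∀ {s : Vec ℕ (suc r)} → Occurs (Π a 1 (suc r)) s → Chain a 0 s
Occurs-Π₁⇒Chain-step {a} {r} Π₂⇒Chain occ
  with _ ∷ z₁ , _ ∷ z₂ , occ₁ , occ₂ , refl ← Occurs-⊗⁻ (factor a 1) (Π a 2 r) occ
  with τ , refl ← Occurs-factor₁⁻ occ₁ =
  subst (λ v → Chain a 0 (_ ∷ v)) (sym (zipWith-identityˡ +-identityˡ z₂)) (τ ∷ Π₂⇒Chain occ₂)

Occurs-Π₂⇒Chain : ∀ {a} r {u} {s : Vec ℕ r} → Occurs (Π {suc r} a 2 r) (u ∷ s) → Chain a u s
Occurs-Π₂⇒Chain zero occ with _ , refl ← Occurs-const⁻ occ = []
Occurs-Π₂⇒Chain {a} (suc r) occ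
  with _ ∷ z₁ , _ ∷ x ∷ z₂ , occ₁ , occ₂ , refl ← Occurs-⊗⁻ (factor a 2) (Π a 3 r) occ
  with refl , occ₂′ ← Occurs-Π₃⁻ a r occ₂
  with Occurs-factor₂⁻ occ₁
... | inj₁ (refl , refl) =
  subst (λ v → Chain a 1 (x ∷ v)) (sym (zipWith-identityˡ +-identityˡ z₂)) (left ∷ Occurs-Π₂⇒Chain r occ₂′)
... | inj₂ (refl , occ₁′) =
  Occurs-Π₁⇒Chain-step (Occurs-Π₂⇒Chain r) (Occurs-⊗⁺ (factor a 1) (Π a 2 r) occ₁′ occ₂′)

Chain⇒Occurs-Π₁-step : ∀ {a r} → (∀ {u} {s : Vec ℕ r} → Chain a u s → Occurs (Π {suc r} a 2 r) (u ∷ s)) →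
                       ∀ {s : Vec ℕ (suc r)} → Chain a 0 s → Occurs (Π a 1 (suc r)) s
Chain⇒Occurs-Π₁-step {a} {r} Chain⇒Π₂ (_∷_ {s = s} τ c) =
  subst (λ v → Occurs (Π a 1 (suc r)) (_ ∷ v)) (zipWith-identityˡ +-identityˡ s)
    (Occurs-⊗⁺ (factor a 1) (Π a 2 r) (Occurs-factor₁⁺ τ) (Chain⇒Π₂ c))

Chain⇒Occurs-Π₂ : ∀ {a} r {u} {s : Vec ℕ r} → Chain a u s → Occurs (Π {suc r} a 2 r) (u ∷ s)
Chain⇒Occurs-Π₂ zero [] = Occurs-const⁺ λ ()
Chain⇒Occurs-Π₂ {a} (suc r) {suc zero} (left ∷ c) =
  subst (λ v → Occurs (Π a 2 (suc r)) (1 ∷ v)) (zipWith-identityˡ +-identityˡ _)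
    (Occurs-⊗⁺ (factor a 2) (Π a 3 r) (Occurs-factor₂⁺ (inj₁ (refl , refl)))
               (Occurs-Π₃⁺ a r (Chain⇒Occurs-Π₂ r c)))
Chain⇒Occurs-Π₂ {a} (suc r) {zero} c
  with e₁ , e₂ , occ₁ , occ₂ , eq ←
         Occurs-⊗⁻ (factor a 1) (Π a 2 r) (Chain⇒Occurs-Π₁-step (Chain⇒Occurs-Π₂ r) c) =
  subst (λ v → Occurs (Π a 2 (suc r)) (0 ∷ v)) (sym eq)
    (Occurs-⊗⁺ (factor a 2) (Π a 3 r) (Occurs-factor₂⁺ (inj₂ (refl , occ₁))) (Occurs-Π₃⁺ a r occ₂))
Chain⇒Occurs-Π₂ (suc r) {suc (suc _)} c with s≤s () ← Chain-start≤1 c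

Occurs-Π₁⇔Chain : ∀ {a} r (s : Vec ℕ r) → Occurs (Π a 1 r) s ⇔ Chain a 0 s
Occurs-Π₁⇔Chain zero    [] = mk⇔ (λ _ → []) (λ { [] → Occurs-const⁺ λ () })
Occurs-Π₁⇔Chain (suc r) s  =
  mk⇔ (Occurs-Π₁⇒Chain-step (Occurs-Π₂⇒Chain r)) (Chain⇒Occurs-Π₁-step (Chain⇒Occurs-Π₂ r))

supp-pna⇔Chain : ∀ n a (s : Vec ℕ n) → supp (pna n a) s ⇔ Chain a 0 s
supp-pna⇔Chain n a s rewrite pna≡Π n a = ⇔-trans (supp⇔Occurs (Π a 1 n) s) (Occurs-Π₁⇔Chain n s)

-- Degrees in the broken wheel

-- Vertex k ≥ 1 has one edge to the hub 0 (two if k = 1, and then k = i), an edge to k - 1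
-- (for k ≥ 2) leaving {i, …, j} iff k = i, and an edge to k + 1 (for k < n) leaving it iff k = j.
bwDegree : ℕ → ℕ → ℕ → ℕ → ℕ
bwDegree n i k j = suc (fromBool (does (k ≟ i)) + fromBool (does (k ≟ j) ∧ does (j <? n)))

private
  outsideᵈ : ℕ → ℕ → ℕ → Bool
  outsideᵈ i j v = does (v <? i) ∨ does (j <? v)

  edgeCountᵈ : ℕ → ℕ → ℕ → ℕ × ℕ → ℕ
  edgeCountᵈ i k j (u , v) = fromBool (does (u ≟ k) ∧ outsideᵈ i j v) + fromBool (does (v ≟ k) ∧ outsideᵈ i j u)

  edgeCount≡ : ∀ i k j e → edgeCount i k j e ≡ edgeCountᵈ i k j e
  edgeCount≡ i k j (u , v) = cong₂ _+_ (cong fromBool (normalise u v)) (cong fromBool (normalise v u))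
    where
    normalise : ∀ x y → ⌊ x ≟ k ⌋ ∧ outside i j y ≡ does (x ≟ k) ∧ outsideᵈ i j y
    normalise x y = cong₂ _∧_ (isYes≗does (x ≟ k)) (cong₂ _∨_ (isYes≗does (y <? i)) (isYes≗does (j <? y)))

  sum-filter : ∀ {P : ℕ → Set} (P? : U.Decidable P) (g : ℕ → ℕ) xs →
               lsum (map g (filter P? xs)) ≡ lsum (map (λ v → if does (P? v) then g v else 0) xs)
  sum-filter P? g []       = refl
  sum-filter P? g (x ∷ xs) with does (P? x)
  ... | true  = cong (g x +_) (sum-filter P? g xs)
  ... | false = sum-filter P? g xs

  sum-map-+ : ∀ (g h : ℕ → ℕ) xs → lsum (map (λ v → g v + h v) xs) ≡ lsum (map g xs) + lsum (map h xs)
  sum-map-+ g h []       = refl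
  sum-map-+ g h (x ∷ xs) = trans (cong (g x + h x +_) (sum-map-+ g h xs))
                                 (+-+-comm (g x) (h x) (lsum (map g xs)) (lsum (map h xs)))
    where
    +-+-comm : ∀ a b c d → a + b + (c + d) ≡ a + c + (b + d)
    +-+-comm = solve 4 (λ a b c d → a :+ b :+ (c :+ d) := a :+ c :+ (b :+ d)) refl
      where open +-*-Solver

  sum-applyUpTo-zero : ∀ (h f : ℕ → ℕ) m → (∀ v → v < m → h (f v) ≡ 0) → lsum (map h (applyUpTo f m)) ≡ 0
  sum-applyUpTo-zero h f zero    _  = refl
  sum-applyUpTo-zero h f (suc m) h≡0 =
    cong₂ _+_ (h≡0 0 z<s) (sum-applyUpTo-zero h (f ∘ suc) m (λ v v<m → h≡0 (suc v) (s<s v<m)))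

  sum-applyUpTo-point : ∀ (h f : ℕ → ℕ) m c → c < m → (∀ v → v < m → v ≢ c → h (f v) ≡ 0) →
                        lsum (map h (applyUpTo f m)) ≡ h (f c)
  sum-applyUpTo-point h f (suc m) zero    _       h≡0 =
    trans (cong (h (f 0) +_) (sum-applyUpTo-zero h (f ∘ suc) m λ v v<m → h≡0 (suc v) (s<s v<m) λ ()))
          (+-identityʳ _)
  sum-applyUpTo-point h f (suc m) (suc c) (s<s c<m) h≡0 =
    cong₂ _+_ (h≡0 0 z<s λ ())
      (sum-applyUpTo-point h (f ∘ suc) m c c<m λ v v<m v≢c → h≡0 (suc v) (s<s v<m) (v≢c ∘ suc-injective))

  outside-right : ∀ {i k j} → i ≤ k → k ≤ j → outsideᵈ i j (suc k) ≡ does (k ≟ j)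
  outside-right {i} {k} {j} i≤k k≤j
    rewrite dec-false (suc k <? i) (λ k<i → <⇒≱ k<i (≤-trans i≤k (n≤1+n k))) with k ≟ j
  ... | yes refl = trans (dec-true (k <? suc k) ≤-refl) (sym (dec-true (k ≟ k) refl))
  ... | no k≢j   = trans (dec-false (j <? suc k) (λ j<1+k → k≢j (≤-antisym k≤j (≤-pred j<1+k))))
                         (sym (dec-false (k ≟ j) k≢j))

  outside-left : ∀ {i c j} → i ≤ suc c → suc c ≤ j → outsideᵈ i j c ≡ does (suc c ≟ i)
  outside-left {i} {c} {j} i≤k k≤j
    rewrite dec-false (j <? c) (λ j<c → <⇒≱ j<c (≤-trans (n≤1+n c) k≤j)) | ∨-identityʳ (does (c <? i))
    with suc c ≟ i
  ... | yes refl = trans (dec-true (c <? suc c) ≤-refl) (sym (dec-true (suc c ≟ suc c) refl))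
  ... | no k≢i   = trans (dec-false (c <? i) (λ c<i → k≢i (≤-antisym c<i i≤k))) (sym (dec-false (suc c ≟ i) k≢i))

  spokes-sum : ∀ {n i k j} → 1 ≤ i → 1 ≤ k → k ≤ n →
    lsum (map (edgeCountᵈ i k j) (map (λ v → (0 , v)) (filter (λ v → 2 ≤? v) (map suc (upTo n)))))
      ≡ fromBool (does (2 ≤? k))
  spokes-sum {n} {suc i} {suc k} {j} _ _ k<n = begin
    lsum (map ec (map (0 ,_) (filter (2 ≤?_) (map suc (upTo n)))))
      ≡⟨ cong lsum (map-∘ (filter (2 ≤?_) (map suc (upTo n)))) ⟨
    lsum (map (ec ∘ (0 ,_)) (filter (2 ≤?_) (map suc (upTo n))))
      ≡⟨ sum-filter (2 ≤?_) (ec ∘ (0 ,_)) (map suc (upTo n)) ⟩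
    lsum (map h (map suc (upTo n)))
      ≡⟨ cong (lsum ∘ map h) (map-upTo suc n) ⟩
    lsum (map h (applyUpTo suc n))
      ≡⟨ sum-applyUpTo-point h suc n k k<n h≡0 ⟩
    h (suc k)
      ≡⟨ cong (λ b → if does (2 ≤? suc k) then fromBool (b ∧ true) else 0) (dec-true (k ≟ k) refl) ⟩
    fromBool (does (2 ≤? suc k)) ∎
    where
    open ≡-Reasoning
    ec : ℕ × ℕ → ℕ
    ec = edgeCountᵈ (suc i) (suc k) j
    h : ℕ → ℕ
    h v = if does (2 ≤? v) then ec (0 , v) else 0
    h≡0 : ∀ v → v < n → v ≢ k → h (suc v) ≡ 0
    h≡0 zero    _ _   = refl
    h≡0 (suc v) _ v≢k rewrite dec-false (suc v ≟ k) v≢k = refl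

  pathRight pathLeft : ℕ → ℕ → ℕ → ℕ → ℕ
  pathRight i k j v = fromBool (does (suc v ≟ k) ∧ outsideᵈ i j (suc (suc v)))
  pathLeft  i k j v = fromBool (does (suc (suc v) ≟ k) ∧ outsideᵈ i j (suc v))

  pathRight-sum : ∀ {n i k j} → i ≤ k → k ≤ j → j ≤ n → 1 ≤ k →
                  lsum (map (pathRight i k j) (upTo (n ∸ 1))) ≡ fromBool (does (k ≟ j) ∧ does (j <? n))
  pathRight-sum {n} {i} {suc k} {j} i≤k k≤j j≤n _ with suc k <? n
  ... | yes k<n = begin
    lsum (map (pathRight i (suc k) j) (upTo (n ∸ 1)))
      ≡⟨ sum-applyUpTo-point (pathRight i (suc k) j) id (n ∸ 1) k (∸-monoˡ-≤ 1 k<n) R≡0 ⟩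
    fromBool (does (k ≟ k) ∧ outsideᵈ i j (suc (suc k)))
      ≡⟨ cong fromBool (cong₂ _∧_ (dec-true (k ≟ k) refl) (outside-right i≤k k≤j)) ⟩
    fromBool (does (suc k ≟ j))
      ≡⟨ cong fromBool reaches-end ⟩
    fromBool (does (suc k ≟ j) ∧ does (j <? n)) ∎
    where
    open ≡-Reasoning
    R≡0 : ∀ v → v < n ∸ 1 → v ≢ k → pathRight i (suc k) j v ≡ 0
    R≡0 v _ v≢k rewrite dec-false (v ≟ k) v≢k = refl
    reaches-end : does (suc k ≟ j) ≡ does (suc k ≟ j) ∧ does (j <? n)
    reaches-end with suc k ≟ j
    ... | yes refl rewrite dec-true (suc k ≟ suc k) refl = sym (dec-true (suc k <? n) k<n)
    ... | no k≢j   rewrite dec-false (suc k ≟ j) k≢j = refl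
  ... | no k≮n with refl ← ≤-antisym (≤-trans k≤j j≤n) (≮⇒≥ k≮n) with refl ← ≤-antisym k≤j j≤n = begin
    lsum (map (pathRight i (suc k) (suc k)) (upTo k))
      ≡⟨ sum-applyUpTo-zero _ id k (λ v v<k →
           cong (λ b → fromBool (b ∧ outsideᵈ i (suc k) (suc (suc v)))) (dec-false (v ≟ k) (<⇒≢ v<k))) ⟩
    0
      ≡⟨ cong fromBool (∧-zeroʳ (does (suc k ≟ suc k))) ⟨
    fromBool (does (suc k ≟ suc k) ∧ false)
      ≡⟨ cong (λ b → fromBool (does (suc k ≟ suc k) ∧ b)) (dec-false (suc k <? suc k) (n≮n (suc k))) ⟨
    fromBool (does (suc k ≟ suc k) ∧ does (suc k <? suc k)) ∎
    where open ≡-Reasoning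

  pathLeft-sum : ∀ {n i k j} → i ≤ k → k ≤ j → j ≤ n →
                 lsum (map (pathLeft i k j) (upTo (n ∸ 1))) ≡ fromBool (does (2 ≤? k) ∧ does (k ≟ i))
  pathLeft-sum {n} {k = zero}        _ _ _ = sum-applyUpTo-zero _ id (n ∸ 1) λ _ _ → refl
  pathLeft-sum {n} {k = suc zero}    _ _ _ = sum-applyUpTo-zero _ id (n ∸ 1) λ _ _ → refl
  pathLeft-sum {n} {i} {suc (suc c)} {j} i≤k k≤j j≤n = begin
    lsum (map (pathLeft i (suc (suc c)) j) (upTo (n ∸ 1)))
      ≡⟨ sum-applyUpTo-point _ id (n ∸ 1) c (∸-monoˡ-≤ 1 (≤-trans k≤j j≤n)) L≡0 ⟩
    fromBool (does (c ≟ c) ∧ outsideᵈ i j (suc c))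
      ≡⟨ cong fromBool (cong₂ _∧_ (dec-true (c ≟ c) refl) (outside-left i≤k k≤j)) ⟩
    fromBool (does (suc (suc c) ≟ i)) ∎
    where
    open ≡-Reasoning
    L≡0 : ∀ v → v < n ∸ 1 → v ≢ c → pathLeft i (suc (suc c)) j v ≡ 0
    L≡0 v _ v≢c rewrite dec-false (v ≟ c) v≢c = refl

  path-sum : ∀ {n i k j} → i ≤ k → k ≤ j → j ≤ n → 1 ≤ k →
    lsum (map (edgeCountᵈ i k j) (map (λ v → (v , suc v)) (map suc (upTo (n ∸ 1)))))
      ≡ fromBool (does (k ≟ j) ∧ does (j <? n)) + fromBool (does (2 ≤? k) ∧ does (k ≟ i))
  path-sum {n} {i} {k} {j} i≤k k≤j j≤n 1≤k = begin
    lsum (map (edgeCountᵈ i k j) (map (λ v → (v , suc v)) (map suc (upTo (n ∸ 1)))))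
      ≡⟨ cong lsum (trans (sym (map-∘ (map suc (upTo (n ∸ 1))))) (sym (map-∘ (upTo (n ∸ 1))))) ⟩
    lsum (map (λ v → pathRight i k j v + pathLeft i k j v) (upTo (n ∸ 1)))
      ≡⟨ sum-map-+ (pathRight i k j) (pathLeft i k j) (upTo (n ∸ 1)) ⟩
    lsum (map (pathRight i k j) (upTo (n ∸ 1))) + lsum (map (pathLeft i k j) (upTo (n ∸ 1)))
      ≡⟨ cong₂ _+_ (pathRight-sum i≤k k≤j j≤n 1≤k) (pathLeft-sum i≤k k≤j j≤n) ⟩
    fromBool (does (k ≟ j) ∧ does (j <? n)) + fromBool (does (2 ≤? k) ∧ does (k ≟ i)) ∎
    where open ≡-Reasoning

  contributions≡bwDegree : ∀ {n i k j} → 1 ≤ i → i ≤ k →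
    let ec = edgeCountᵈ i k j in
    ec (0 , 1) + (ec (0 , 1) + (fromBool (does (2 ≤? k)) +
      (fromBool (does (k ≟ j) ∧ does (j <? n)) + fromBool (does (2 ≤? k) ∧ does (k ≟ i)))))
      ≡ bwDegree n i k j
  contributions≡bwDegree {n} {suc zero} {suc zero} {j} _ _ =
    cong (λ x → suc (suc x)) (+-identityʳ (fromBool (does (1 ≟ j) ∧ does (j <? n))))
  contributions≡bwDegree {i = i} {suc (suc c)} _ _ = cong suc (+-comm _ (fromBool (does (suc (suc c) ≟ i))))
  contributions≡bwDegree {i = suc (suc _)} {suc zero} _ (s≤s ())
  contributions≡bwDegree {i = suc _}       {zero}     _ ()

d≡bwDegree : ∀ {n i k j} → 1 ≤ i → i ≤ k → k ≤ j → j ≤ n → d n i k j ≡ bwDegree n i k j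
d≡bwDegree {n} {i} {k} {j} 1≤i i≤k k≤j j≤n = begin
  d n i k j
    ≡⟨ cong lsum (map-cong (edgeCount≡ i k j) (BWedges n)) ⟩
  ec (0 , 1) + (ec (0 , 1) + lsum (map ec (spokes ++ path)))
    ≡⟨ cong (λ x → ec (0 , 1) + (ec (0 , 1) + x)) (trans (cong lsum (map-++ ec spokes path)) (sum-++ (map ec spokes) _)) ⟩
  ec (0 , 1) + (ec (0 , 1) + (lsum (map ec spokes) + lsum (map ec path)))
    ≡⟨ cong (λ x → ec (0 , 1) + (ec (0 , 1) + x))
            (cong₂ _+_ (spokes-sum 1≤i 1≤k (≤-trans k≤j j≤n)) (path-sum i≤k k≤j j≤n 1≤k)) ⟩
  ec (0 , 1) + (ec (0 , 1) + (fromBool (does (2 ≤? k)) +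
    (fromBool (does (k ≟ j) ∧ does (j <? n)) + fromBool (does (2 ≤? k) ∧ does (k ≟ i)))))
    ≡⟨ contributions≡bwDegree {n} 1≤i i≤k ⟩
  bwDegree n i k j ∎
  where
  open ≡-Reasoning
  1≤k : 1 ≤ k
  1≤k = ≤-trans 1≤i i≤k
  ec : ℕ × ℕ → ℕ
  ec = edgeCountᵈ i k j
  spokes path : List (ℕ × ℕ)
  spokes = map (λ v → (0 , v)) (filter (λ v → 2 ≤? v) (map suc (upTo n)))
  path   = map (λ v → (v , suc v)) (map suc (upTo (n ∸ 1)))

-- Parking functions

Parked : ∀ {m} → (ℕ → ℕ → ℕ → ℕ) → Vec ℕ m → ℕ → ℕ → Set
Parked deg s i j = ∃[ k ] (i ≤ k × k ≤ j × at s k < deg i k j)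

Parking : ∀ {m} → (ℕ → ℕ → ℕ → ℕ) → Vec ℕ m → Set
Parking {m} deg s = ∀ i j → 1 ≤ i → i ≤ j → j ≤ m → Parked deg s i j

Parking-cong : ∀ {m deg deg′} {s : Vec ℕ m} →
               (∀ {i k j} → 1 ≤ i → i ≤ k → k ≤ j → j ≤ m → deg i k j ≡ deg′ i k j) →
               Parking deg s → Parking deg′ s
Parking-cong {s = s} deg≡ p i j 1≤i i≤j j≤m with k , i≤k , k≤j , lt ← p i j 1≤i i≤j j≤m =
  k , i≤k , k≤j , subst (at s k <_) (deg≡ 1≤i i≤k k≤j j≤m) lt

IsParking : ∀ {m} → Vec ℕ m → Set
IsParking {m} = Parking (bwDegree m)

ParkedFromStart : ∀ {m} → Vec ℕ m → Set
ParkedFromStart {m} s = ∀ j → 1 ≤ j → j ≤ m → Parked (bwDegree m) s 1 j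

S⇔IsParking : ∀ {n} (s : Vec ℕ n) → S n s ⇔ IsParking s
S⇔IsParking s = mk⇔ (Parking-cong d≡bwDegree)
                    (Parking-cong λ 1≤i i≤k k≤j j≤n → sym (d≡bwDegree 1≤i i≤k k≤j j≤n))

at-∷ : ∀ {m} x (s : Vec ℕ m) k → at (x ∷ s) (suc (suc k)) ≡ at s (suc k)
at-∷ {m} x s k with suc k <? suc m | k <? m
... | yes _     | yes _   = refl
... | no _      | no _    = refl
... | no ¬k<m   | yes k<m = contradiction (s≤s k<m) ¬k<m
... | yes 1+k<m | no ¬k<m = contradiction (≤-pred 1+k<m) ¬k<m

Parked-∷⁺ : ∀ {m x i j} {s : Vec ℕ m} → 1 ≤ i → Parked (bwDegree m) s i j →
            Parked (bwDegree (suc m)) (x ∷ s) (suc i) (suc j)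
Parked-∷⁺ (s≤s _) (zero , () , _)
Parked-∷⁺ {x = x} {s = s} _ (suc k , i≤k , k≤j , lt) =
  suc (suc k) , s≤s i≤k , s≤s k≤j , subst (_< _) (sym (at-∷ x s k)) lt

Parked-∷⁻ : ∀ {m x i j} {s : Vec ℕ m} → 1 ≤ i → Parked (bwDegree (suc m)) (x ∷ s) (suc i) (suc j) →
            Parked (bwDegree m) s i j
Parked-∷⁻ {x = x} {s = s} (s≤s _) (suc (suc k) , s≤s i≤k , s≤s k≤j , lt) =
  suc k , i≤k , k≤j , subst (_< _) (at-∷ x s k) lt

IsParking-∷⁻ : ∀ {m x} {s : Vec ℕ m} → IsParking (x ∷ s) → ParkedFromStart (x ∷ s) × IsParking s
IsParking-∷⁻ p = (λ j → p 1 j ≤-refl) ,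
                 (λ i j 1≤i i≤j j≤m → Parked-∷⁻ 1≤i (p (suc i) (suc j) (s≤s z≤n) (s≤s i≤j) (s≤s j≤m)))

IsParking-∷⁺ : ∀ {m x} {s : Vec ℕ m} → ParkedFromStart (x ∷ s) → IsParking s → IsParking (x ∷ s)
IsParking-∷⁺ front p (suc zero)    j       _ 1≤j       j≤m       = front j 1≤j j≤m
IsParking-∷⁺ front p (suc (suc i)) (suc j) _ (s≤s i≤j) (s≤s j≤m) =
  Parked-∷⁺ (s≤s z≤n) (p (suc i) j (s≤s z≤n) i≤j j≤m)

IsParking-[] : IsParking []
IsParking-[] _ _ 1≤i i≤j j≤0 = contradiction (≤-trans 1≤i (≤-trans i≤j j≤0)) λ ()

private
  fromBool≤1 : ∀ b → fromBool b ≤ 1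
  fromBool≤1 true  = ≤-refl
  fromBool≤1 false = z≤n

ParkedFromStart-≤1 : ∀ {m x} {s : Vec ℕ m} → x ≤ 1 → ParkedFromStart (x ∷ s)
ParkedFromStart-≤1 x≤1 j 1≤j _ = 1 , ≤-refl , 1≤j , s≤s (≤-trans x≤1 (s≤s z≤n))

ParkedFromStart⇒≤2 : ∀ {m x} {s : Vec ℕ m} → ParkedFromStart (x ∷ s) → x ≤ 2
ParkedFromStart⇒≤2 {m} front with front 1 ≤-refl (s≤s z≤n)
... | suc zero    , _ , _     , s≤s x≤ = ≤-trans x≤ (s≤s (fromBool≤1 (does (1 <? suc m))))
... | suc (suc _) , _ , s≤s () , _

¬ParkedFromStart-2∷[] : ¬ ParkedFromStart (2 ∷ [])
¬ParkedFromStart-2∷[] front with front 1 ≤-refl ≤-refl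
... | suc zero    , _ , _     , s≤s (s≤s ())
... | suc (suc _) , _ , s≤s () , _

private
  at-∷∷ : ∀ {m} x y (s : Vec ℕ m) k → at (x ∷ y ∷ s) (3 + k) ≡ at (x ∷ s) (2 + k)
  at-∷∷ x y s k = trans (at-∷ x (y ∷ s) (suc k)) (trans (at-∷ y s k) (sym (at-∷ x s k)))

  ParkedFromStart-2∷1∷⇒ : ∀ {m} {s : Vec ℕ (suc m)} → ParkedFromStart (2 ∷ 1 ∷ s) → ParkedFromStart (2 ∷ s)
  ParkedFromStart-2∷1∷⇒ front (suc zero) _ _ = 1 , ≤-refl , ≤-refl , ≤-refl
  ParkedFromStart-2∷1∷⇒ {s = s} front (suc (suc j)) _ (s≤s j≤m)
    with front (suc (suc (suc j))) (s≤s z≤n) (s≤s (s≤s j≤m))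
  ... | suc zero          , _ , _       , s≤s (s≤s ())
  ... | suc (suc zero)    , _ , _       , s≤s ()
  ... | suc (suc (suc k)) , _ , s≤s k≤j , lt = suc (suc k) , s≤s z≤n , k≤j , subst (_< _) (at-∷∷ 2 1 s k) lt

ParkedFromStart-2∷⁻ : ∀ {m x} {s : Vec ℕ m} → ParkedFromStart (2 ∷ x ∷ s) →
                      x ≡ 0 ⊎ (x ≡ 1 × ParkedFromStart (2 ∷ s))
ParkedFromStart-2∷⁻ {x = zero} _ = inj₁ refl
ParkedFromStart-2∷⁻ {m} {suc x} front with front 2 (s≤s z≤n) (s≤s (s≤s z≤n))
... | suc zero          , _ , _           , s≤s (s≤s ())
... | suc (suc (suc _)) , _ , s≤s (s≤s ()) , _
ParkedFromStart-2∷⁻ {zero}  {suc x} front | suc (suc zero) , _ , _ , s≤s ()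
ParkedFromStart-2∷⁻ {suc m} {suc x} front | suc (suc zero) , _ , _ , s≤s (s≤s z≤n) =
  inj₂ (refl , ParkedFromStart-2∷1∷⇒ front)

ParkedFromStart-2∷⁺ : ∀ {m x} {s : Vec ℕ m} → x ≡ 0 ⊎ (x ≡ 1 × ParkedFromStart (2 ∷ s)) →
                      ParkedFromStart (2 ∷ x ∷ s)
ParkedFromStart-2∷⁺ _           (suc zero)    _ _ = 1 , ≤-refl , ≤-refl , ≤-refl
ParkedFromStart-2∷⁺ (inj₁ refl) (suc (suc j)) _ _ = 2 , s≤s z≤n , s≤s (s≤s z≤n) , s≤s z≤n
ParkedFromStart-2∷⁺ {s = s} (inj₂ (refl , front)) (suc (suc j)) _ (s≤s j≤m) with front (suc j) (s≤s z≤n) j≤m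
... | suc (suc k) , _ , k≤j , lt = suc (suc (suc k)) , s≤s z≤n , s≤s k≤j , subst (_< _) (sym (at-∷∷ 2 1 s k)) lt
ParkedFromStart-2∷⁺ {zero}  (inj₂ (refl , _)) (suc (suc zero))    _ _ | suc zero , _ , _ , s≤s (s≤s ())
ParkedFromStart-2∷⁺ {suc _} (inj₂ (refl , _)) (suc (suc zero))    _ _ | suc zero , _ , _ , _ =
  2 , s≤s z≤n , ≤-refl , ≤-refl
ParkedFromStart-2∷⁺         (inj₂ (refl , _)) (suc (suc (suc _))) _ _ | suc zero , _ , _ , s≤s (s≤s ())

Chain⇒IsParking  : ∀ {m} {s : Vec ℕ m} → Chain 1 0 s → IsParking s
Chain₁⇒IsParking : ∀ {m} {s : Vec ℕ m} → Chain 1 1 s → IsParking (2 ∷ s)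
Chain⇒IsParking []                                  = IsParking-[]
Chain⇒IsParking (_∷_ {u′ = zero}        constant c) = IsParking-∷⁺ (ParkedFromStart-≤1 z≤n) (Chain⇒IsParking c)
Chain⇒IsParking (_∷_ {u′ = zero}        right    c) = IsParking-∷⁺ (ParkedFromStart-≤1 ≤-refl) (Chain⇒IsParking c)
Chain⇒IsParking (_∷_ {u′ = suc zero}    constant c) =
  IsParking-∷⁺ (ParkedFromStart-≤1 ≤-refl) (proj₂ (IsParking-∷⁻ (Chain₁⇒IsParking c)))
Chain⇒IsParking (_∷_ {u′ = suc zero}    right    c) = Chain₁⇒IsParking c
Chain⇒IsParking (_∷_ {u′ = suc (suc _)} _        c) with s≤s () ← Chain-start≤1 c
Chain₁⇒IsParking (_∷_ {u′ = zero} left c) =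
  IsParking-∷⁺ (ParkedFromStart-2∷⁺ (inj₁ refl)) (IsParking-∷⁺ (ParkedFromStart-≤1 z≤n) (Chain⇒IsParking c))
Chain₁⇒IsParking (_∷_ {u′ = suc zero} left c) with front , p ← IsParking-∷⁻ (Chain₁⇒IsParking c) =
  IsParking-∷⁺ (ParkedFromStart-2∷⁺ (inj₂ (refl , front))) (IsParking-∷⁺ (ParkedFromStart-≤1 ≤-refl) p)
Chain₁⇒IsParking (_∷_ {u′ = suc (suc _)} _ c) with s≤s () ← Chain-start≤1 c

IsParking⇒Chain  : ∀ {m} {s : Vec ℕ m} → IsParking s → Chain 1 0 s
IsParking⇒Chain₁ : ∀ {m} {s : Vec ℕ m} → IsParking (2 ∷ s) → Chain 1 1 s
IsParking⇒Chain {s = []} _ = []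
IsParking⇒Chain {s = x ∷ s} p with front , p′ ← IsParking-∷⁻ p with x | ParkedFromStart⇒≤2 front
... | zero              | _ = constant ∷ IsParking⇒Chain p′
... | suc zero          | _ = right ∷ IsParking⇒Chain p′
... | suc (suc zero)    | _ = right ∷ IsParking⇒Chain₁ p
... | suc (suc (suc _)) | s≤s (s≤s ())
IsParking⇒Chain₁ {s = []} p = contradiction (proj₁ (IsParking-∷⁻ p)) ¬ParkedFromStart-2∷[]
IsParking⇒Chain₁ {s = x ∷ s} p
  with front , p′ ← IsParking-∷⁻ p
  with _ , p″ ← IsParking-∷⁻ p′ | ParkedFromStart-2∷⁻ front
... | inj₁ refl            = left ∷ IsParking⇒Chain p″
... | inj₂ (refl , front′) = left ∷ IsParking⇒Chain₁ (IsParking-∷⁺ front′ p″)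

S⇔Chain : ∀ {n} (s : Vec ℕ n) → S n s ⇔ Chain 1 0 s
S⇔Chain s = ⇔-trans (S⇔IsParking s) (mk⇔ IsParking⇒Chain Chain⇒IsParking)

Smax⇔Chain : ∀ {n} (s : Vec ℕ n) → Smax n s ⇔ Chain 0 0 s
Smax⇔Chain s = mk⇔
  (λ (p , sum≡n) → Chain-tight (Equivalence.to (S⇔Chain s) p) (trans (+-identityʳ _) sum≡n))
  (λ c → Equivalence.from (S⇔Chain s) (Chain-weaken c) , trans (sym (+-identityʳ _)) (Chain₀-sum c))

-- Enumeration

rightExponents : ℕ → ℕ → List ℕ
rightExponents a       (suc zero)    = 0 ∷ []
rightExponents a       (suc (suc _)) = []
rightExponents zero    zero          = 1 ∷ []
rightExponents (suc _) zero          = 1 ∷ 0 ∷ []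

∈-rightExponents⁺ : ∀ {a u y} → Term a u y → y ∈ rightExponents a u
∈-rightExponents⁺ constant = there (here refl)
∈-rightExponents⁺ left     = here refl
∈-rightExponents⁺ {zero}  right = here refl
∈-rightExponents⁺ {suc _} right = here refl

∈-rightExponents⁻ : ∀ {a u y} → y ∈ rightExponents a u → Term a u y
∈-rightExponents⁻ {u = suc zero} (here refl)         = left
∈-rightExponents⁻ {zero}  {zero} (here refl)         = right
∈-rightExponents⁻ {suc _} {zero} (here refl)         = right
∈-rightExponents⁻ {suc _} {zero} (there (here refl)) = constant

chains      : (a u m : ℕ) → List (Vec ℕ m)
chainsAfter : (a y m : ℕ) → List (Vec ℕ (suc m))
chains a u       (suc m) = concatMap (λ y → chainsAfter a y m) (rightExponents a u)
chains a zero    zero    = [] ∷ []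
chains a (suc _) zero    = []
chainsAfter a y m = map ((y + 0) ∷_) (chains a 0 m) ++ map ((y + 1) ∷_) (chains a 1 m)

∈-chains⁺      : ∀ {a u m} {s : Vec ℕ m} → Chain a u s → s ∈ chains a u m
∈-chainsAfter⁺ : ∀ {a y u m} {s : Vec ℕ m} → Chain a u s → (y + u ∷ s) ∈ chainsAfter a y m
∈-chains⁺ []      = here refl
∈-chains⁺ (τ ∷ c) = ∈-concatMap⁺ _ (lose (∈-rightExponents⁺ τ) (∈-chainsAfter⁺ c))
∈-chainsAfter⁺ {u = zero}        c = ∈-++⁺ˡ (∈-map⁺ _ (∈-chains⁺ c))
∈-chainsAfter⁺ {u = suc zero}    c = ∈-++⁺ʳ _ (∈-map⁺ _ (∈-chains⁺ c))
∈-chainsAfter⁺ {u = suc (suc _)} c with s≤s () ← Chain-start≤1 c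

∈-chains⁻      : ∀ {a u m} {s : Vec ℕ m} → s ∈ chains a u m → Chain a u s
∈-chainsAfter⁻ : ∀ {a u y m} {s : Vec ℕ (suc m)} → Term a u y → s ∈ chainsAfter a y m → Chain a u s
∈-chains⁻ {u = zero} {zero} (here refl) = []
∈-chains⁻ {a} {u} {suc m} s∈
  with _ , y∈ , s∈′ ← find (∈-concatMap⁻ (λ y → chainsAfter a y m) {rightExponents a u} s∈) =
  ∈-chainsAfter⁻ (∈-rightExponents⁻ y∈) s∈′
∈-chainsAfter⁻ {a} {y = y} {m} τ s∈ with ∈-++⁻ (map ((y + 0) ∷_) (chains a 0 m)) s∈
... | inj₁ s∈₀ with _ , s′∈ , refl ← ∈-map⁻ _ s∈₀ = τ ∷ ∈-chains⁻ s′∈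
... | inj₂ s∈₁ with _ , s′∈ , refl ← ∈-map⁻ _ s∈₁ = τ ∷ ∈-chains⁻ s′∈

∈-chains⇔Chain : ∀ {a u m} (s : Vec ℕ m) → s ∈ chains a u m ⇔ Chain a u s
∈-chains⇔Chain _ = mk⇔ ∈-chains⁻ ∈-chains⁺

Unique-chains₀      : ∀ u m → Unique (chains 0 u m)
Unique-chainsAfter₀ : ∀ y m → Unique (chainsAfter 0 y m)
Unique-chains₀ zero          zero    = [] ∷ []
Unique-chains₀ (suc _)       zero    = []
Unique-chains₀ zero          (suc m) = ++⁺ (Unique-chainsAfter₀ 1 m) [] (λ ())
Unique-chains₀ (suc zero)    (suc m) = ++⁺ (Unique-chainsAfter₀ 0 m) [] (λ ())
Unique-chains₀ (suc (suc _)) (suc m) = []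
Unique-chainsAfter₀ y m =
  ++⁺ (map⁺ ∷-injectiveʳ (Unique-chains₀ 0 m)) (map⁺ ∷-injectiveʳ (Unique-chains₀ 1 m)) heads-differ
  where
  heads-differ : ∀ {s} → ¬ (s ∈ map ((y + 0) ∷_) (chains 0 0 m) × s ∈ map ((y + 1) ∷_) (chains 0 1 m))
  heads-differ (s∈₀ , s∈₁) with _ , _ , refl ← ∈-map⁻ _ s∈₀ | _ , _ , eq ← ∈-map⁻ _ s∈₁ =
    0≢1+n (+-cancelˡ-≡ y 0 1 (∷-injectiveˡ eq))

private
  length-concatMap : ∀ {A B : Set} (f : A → List B) {ℓ} → (∀ x → length (f x) ≡ ℓ) →
                     ∀ xs → length (concatMap f xs) ≡ length xs * ℓ
  length-concatMap f f≡ []       = refl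
  length-concatMap f f≡ (x ∷ xs) = trans (length-++ (f x)) (cong₂ _+_ (f≡ x) (length-concatMap f f≡ xs))

#chains : ℕ → ℕ → ℕ
#chains a m = length (chains a 0 m) + length (chains a 1 m)

length-chainsAfter : ∀ a y m → length (chainsAfter a y m) ≡ #chains a m
length-chainsAfter a y m = trans (length-++ (map ((y + 0) ∷_) (chains a 0 m)))
  (cong₂ _+_ (length-map _ (chains a 0 m)) (length-map _ (chains a 1 m)))

length-chains : ∀ a u m → length (chains a u (suc m)) ≡ length (rightExponents a u) * #chains a m
length-chains a u m =
  length-concatMap (λ y → chainsAfter a y m) (λ y → length-chainsAfter a y m) (rightExponents a u)

#chains≡ : ∀ a m → #chains a m ≡ (length (rightExponents a 0) + length (rightExponents a 1)) ^ m
#chains≡ a zero    = refl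
#chains≡ a (suc m) = begin
  length (chains a 0 (suc m)) + length (chains a 1 (suc m))
    ≡⟨ cong₂ _+_ (length-chains a 0 m) (length-chains a 1 m) ⟩
  r₀ * #chains a m + r₁ * #chains a m ≡⟨ *-distribʳ-+ (#chains a m) r₀ r₁ ⟨
  (r₀ + r₁) * #chains a m             ≡⟨ cong ((r₀ + r₁) *_) (#chains≡ a m) ⟩
  (r₀ + r₁) ^ suc m                   ∎
  where
  open ≡-Reasoning
  r₀ r₁ : ℕ
  r₀ = length (rightExponents a 0)
  r₁ = length (rightExponents a 1)

length-chains₀ : ∀ n → length (chains 0 0 n) ≡ 2 ^ (n ∸ 1)
length-chains₀ zero    = refl
length-chains₀ (suc m) = trans (length-chains 0 0 m) (trans (*-identityˡ (#chains 0 m)) (#chains≡ 0 m))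

length-chains₁≤ : ∀ n → length (chains 1 0 n) ≤ 2 * 3 ^ (n ∸ 1)
length-chains₁≤ zero    = s≤s z≤n
length-chains₁≤ (suc m) = ≤-reflexive (trans (length-chains 1 0 m) (cong (2 *_) (#chains≡ 1 m)))

proposition2 : (n : ℕ) → 1 ≤ n →
    ((s : Vec ℕ n) → Smax n s ⇔ supp (pna n 0) s) ×
    ((s : Vec ℕ n) → S n s ⇔ supp (pna n 1) s) ×
    (∃[ xs ] (Unique xs × ((s : Vec ℕ n) → s ∈ xs ⇔ Smax n s) × length xs ≡ 2 ^ (n ∸ 1))) ×
    (∃[ xs ] (Unique xs × ((s : Vec ℕ n) → s ∈ xs ⇔ S n s) × length xs ≤ 2 * 3 ^ (n ∸ 1)))
proposition2 n _ =
  (λ s → ⇔-trans (Smax⇔Chain s) (⇔-sym (supp-pna⇔Chain n 0 s))) ,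
  (λ s → ⇔-trans (S⇔Chain s) (⇔-sym (supp-pna⇔Chain n 1 s))) ,
  (chains 0 0 n , Unique-chains₀ 0 n ,
    (λ s → ⇔-trans (∈-chains⇔Chain s) (⇔-sym (Smax⇔Chain s))) ,
    length-chains₀ n) ,
  (deduplicate _≟ᵥ_ (chains 1 0 n) , deduplicate-! _≟ᵥ_ (chains 1 0 n) ,
    (λ s → ⇔-trans (⇔-sym (deduplicate-∈⇔ _≟ᵥ_)) (⇔-trans (∈-chains⇔Chain s) (⇔-sym (S⇔Chain s)))) ,
    ≤-trans (length-deduplicate _≟ᵥ_ (chains 1 0 n)) (length-chains₁≤ n))
  where
  _≟ᵥ_ : DecidableEquality (Vec ℕ n)
  _≟ᵥ_ = ≡-dec _≟_
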